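{- Let $\Sigma$ be a finite set with $|\Sigma|\ge 2$, let $\Pi \subseteq \Sigma^*$, let $\Gamma$ be the set of all (not necessarily proper) prefixes of elements of $\Pi$, and let $p(n) = |\Sigma^n \cap \Pi|$. If for every $\pi \in \Pi$ there is $c \in \Sigma$ such that $\pi c \notin \Gamma$, then $$\lim_{n \to \infty} \frac{p(n)}{|\Sigma|^n} = 0 .$$ -}

module Defs where

open import Data.Nat using (ℕ; zero; suc)
open import Data.Fin using (Fin)
open import Data.List using (List; []; _∷_; [_]; _++_; map; concatMap; filter; length; allFin)
open import Data.Product using (∃; ∃-syntax; _×_)
open import Level using (0ℓ)
open import Relation.Unary using (Pred; Decidable)
open import Relation.Binary.PropositionalEquality using (_≡_)

Word : ℕ → Set
Word k = List (Fin k)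

words : (k n : ℕ) → List (Word k)
words k zero    = [] ∷ []
words k (suc n) = concatMap (λ c → map (c ∷_) (words k n)) (allFin k)

IsPrefix : ∀ {k} → Word k → Word k → Set
IsPrefix γ π = ∃[ s ] (γ ++ s ≡ π)

Prefixes : ∀ {k} → Pred (Word k) 0ℓ → Pred (Word k) 0ℓ
Prefixes Π γ = ∃[ π ] (Π π × IsPrefix γ π)

count : ∀ {k} (Π : Pred (Word k) 0ℓ) → Decidable Π → ℕ → ℕ
count {k} Π Π? n = length (filter Π? (words k n))

-- Give the word π ∈ Π of length j the weight k^-(j+1), the measure of the cylinder of infinite
-- words beginning with π c_π, where π c_π is the extension of π that no element of Π passes
-- through.  These cylinders are pairwise disjoint, so Σ_j p(j) / k^(j+1) ≤ 1 (a Kraft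
-- inequality), and the terms of a convergent series tend to 0.  Concretely, for a given m the
-- indices n with k^n ≤ (m+1) p(n) each contribute at least 1/(m+1) to that sum, so there are
-- at most k (m+1) of them.  Only the final step, from "finitely many exceptions" to an explicit
-- threshold N, is classical.
module Submission where

open import Defs
open import Axiom.ExcludedMiddle using (ExcludedMiddle)
open import Axiom.DoubleNegationElimination using (em⇒dne)
open import Level using (Level; 0ℓ)
open import Data.Nat using (ℕ; zero; suc; _+_; _*_; _^_; _≤_; _<_; _≤′_; ≤′-refl; ≤′-step; z≤n; s≤s; _≤?_)
open import Data.Nat.Properties
open import Data.Nat.ListAction using (sum)
open import Data.Nat.ListAction.Properties using (sum-++)
open import Data.Nat.Tactic.RingSolver using (solve-∀)
open import Data.Fin using (Fin; zero; suc)
open import Data.List using (List; []; _∷_; [_]; _++_; map; concatMap; filter; length; tabulate; allFin)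
open import Data.List.Properties using (++-assoc; ++-identityʳ; map-++; map-∘; map-cong)
open import Data.Product using (∃-syntax; _,_; map₂)
open import Data.Vec.Functional using (removeAt)
open import Function using (_∘_; id)
open import Relation.Nullary using (¬_; Dec; yes; no; contradiction; ¬¬-map)
open import Relation.Unary using (Pred; Decidable; ∁)
open import Relation.Binary.PropositionalEquality using (_≡_; refl; sym; trans; cong; cong₂; module ≡-Reasoning)
open import Algebra.Properties.Semiring.Sum +-*-semiring
  using (sum-syntax; sum-remove; ∑-distrib-+; sum-cong-≗; sum-replicate-zero; *-distribˡ-sum)

private
  variable
    a p : Level
    A B : Set a

indicator : {A : Set a} → Dec A → ℕ
indicator (yes _) = 1
indicator (no _)  = 0

length-filter≡sum-indicator : {P : Pred A p} (P? : Decidable P) (xs : List A) →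
                              length (filter P? xs) ≡ sum (map (indicator ∘ P?) xs)
length-filter≡sum-indicator P? []       = refl
length-filter≡sum-indicator P? (x ∷ xs) with P? x
... | yes _ = cong suc (length-filter≡sum-indicator P? xs)
... | no _  = length-filter≡sum-indicator P? xs

sum-map-concatMap-tabulate : ∀ {n} (f : B → ℕ) (g : A → List B) (h : Fin n → A) →
                             sum (map f (concatMap g (tabulate h))) ≡ ∑[ i < n ] sum (map f (g (h i)))
sum-map-concatMap-tabulate {n = zero}  f g h = refl
sum-map-concatMap-tabulate {n = suc n} f g h = begin
  sum (map f (g (h zero) ++ concatMap g (tabulate (h ∘ suc))))
    ≡⟨ cong sum (map-++ f (g (h zero)) _) ⟩
  sum (map f (g (h zero)) ++ map f (concatMap g (tabulate (h ∘ suc))))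
    ≡⟨ sum-++ (map f (g (h zero))) _ ⟩
  sum (map f (g (h zero))) + sum (map f (concatMap g (tabulate (h ∘ suc))))
    ≡⟨ cong (sum (map f (g (h zero))) +_) (sum-map-concatMap-tabulate f g (h ∘ suc)) ⟩
  ∑[ i < suc n ] sum (map f (g (h i))) ∎
  where open ≡-Reasoning

∑-≤ : ∀ {n b} (t : Fin n → ℕ) → (∀ i → t i ≤ b) → ∑[ i < n ] t i ≤ n * b
∑-≤ {zero}  t t≤b = z≤n
∑-≤ {suc n} t t≤b = +-mono-≤ (t≤b zero) (∑-≤ (t ∘ suc) (t≤b ∘ suc))

∑-≤-vanishing : ∀ {n b} (t : Fin n → ℕ) (i : Fin n) → (∀ j → t j ≤ b) → t i ≡ 0 →
                b + ∑[ j < n ] t j ≤ n * b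
∑-≤-vanishing {suc n} {b} t i t≤b tᵢ≡0 = begin
  b + ∑[ j < suc n ] t j  ≡⟨ cong (b +_) (sum-remove t) ⟩
  b + (t i + rest)        ≡⟨ cong (λ x → b + (x + rest)) tᵢ≡0 ⟩
  b + rest                ≤⟨ +-monoʳ-≤ b (∑-≤ (removeAt t i) (λ _ → t≤b _)) ⟩
  suc n * b               ∎
  where
  open ≤-Reasoning
  rest : ℕ
  rest = ∑[ j < n ] removeAt t i j

horner : ℕ → (ℕ → ℕ) → ℕ → ℕ
horner b a zero    = 0
horner b a (suc d) = b * horner b a d + a d

horner-cong : ∀ b {a a′ : ℕ → ℕ} → (∀ j → a j ≡ a′ j) → ∀ d → horner b a d ≡ horner b a′ d
horner-cong b a≗a′ zero    = refl
horner-cong b a≗a′ (suc d) = cong₂ (λ h x → b * h + x) (horner-cong b a≗a′ d) (a≗a′ d)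

horner-zeros : ∀ b {a : ℕ → ℕ} → (∀ j → a j ≡ 0) → ∀ d → horner b a d ≡ 0
horner-zeros b a≗0 zero    = refl
horner-zeros b a≗0 (suc d) rewrite horner-zeros b a≗0 d | a≗0 d = cong (_+ 0) (*-zeroʳ b)

horner-*ˡ : ∀ b c (a : ℕ → ℕ) d → horner b (λ j → c * a j) d ≡ c * horner b a d
horner-*ˡ b c a zero    = sym (*-zeroʳ c)
horner-*ˡ b c a (suc d) = begin
  b * horner b (λ j → c * a j) d + c * a d ≡⟨ cong (λ h → b * h + c * a d) (horner-*ˡ b c a d) ⟩
  b * (c * horner b a d) + c * a d         ≡⟨ swap b c (horner b a d) (a d) ⟩
  c * (b * horner b a d + a d)             ∎
  where
  open ≡-Reasoning
  swap : ∀ b c h x → b * (c * h) + c * x ≡ c * (b * h + x)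
  swap = solve-∀

horner-shift : ∀ b (a : ℕ → ℕ) d → horner b a (suc d) ≡ a 0 * b ^ d + horner b (a ∘ suc) d
horner-shift b a zero    = base b (a 0)
  where
  base : ∀ b x → b * 0 + x ≡ x * 1 + 0
  base = solve-∀
horner-shift b a (suc d) = begin
  b * horner b a (suc d) + a (suc d)                  ≡⟨ cong (λ h → b * h + a (suc d)) (horner-shift b a d) ⟩
  b * (a 0 * b ^ d + horner b (a ∘ suc) d) + a (suc d) ≡⟨ regroup b (a 0) (b ^ d) (horner b (a ∘ suc) d) (a (suc d)) ⟩
  a 0 * (b * b ^ d) + (b * horner b (a ∘ suc) d + a (suc d)) ∎
  where
  open ≡-Reasoning
  regroup : ∀ b x q h y → b * (x * q + h) + y ≡ x * (b * q) + (b * h + y)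
  regroup = solve-∀

horner-∑ : ∀ b {n} (f : Fin n → ℕ → ℕ) d → horner b (λ j → ∑[ i < n ] f i j) d ≡ ∑[ i < n ] horner b (f i) d
horner-∑ b {n} f zero    = sym (sum-replicate-zero n)
horner-∑ b {n} f (suc d) = begin
  b * horner b (λ j → ∑[ i < n ] f i j) d + ∑[ i < n ] f i d
    ≡⟨ cong (λ h → b * h + ∑[ i < n ] f i d) (horner-∑ b f d) ⟩
  b * ∑[ i < n ] horner b (f i) d + ∑[ i < n ] f i d
    ≡⟨ cong (_+ ∑[ i < n ] f i d) (*-distribˡ-sum b (λ i → horner b (f i) d)) ⟩
  ∑[ i < n ] (b * horner b (f i) d) + ∑[ i < n ] f i d
    ≡⟨ sym (∑-distrib-+ (λ i → b * horner b (f i) d) (λ i → f i d)) ⟩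
  ∑[ i < n ] (b * horner b (f i) d + f i d) ∎
  where open ≡-Reasoning

countBelow : {P : Pred ℕ p} → Decidable P → ℕ → ℕ
countBelow P? zero    = 0
countBelow P? (suc d) = indicator (P? d) + countBelow P? d

Eventually : Pred ℕ p → Set p
Eventually Q = ∃[ N ] (∀ n → N ≤ n → Q n)

module _ {P : Pred ℕ p} (P? : Decidable P) where

  countBelow-mono : ∀ {d n} → d ≤′ n → countBelow P? d ≤ countBelow P? n
  countBelow-mono ≤′-refl        = ≤-refl
  countBelow-mono (≤′-step d≤′n) = ≤-trans (countBelow-mono d≤′n) (m≤n+m _ (indicator (P? _)))

  countBelow-suc : ∀ {n} → P n → countBelow P? (suc n) ≡ suc (countBelow P? n)
  countBelow-suc {n} Pn with P? n
  ... | yes _  = refl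
  ... | no ¬Pn = contradiction Pn ¬Pn

  indicator-weight : ∀ b (a : ℕ → ℕ) → (∀ j → P j → b ^ j ≤ a j) → ∀ d → indicator (P? d) * b ^ suc d ≤ b * a d
  indicator-weight b a heavy d with P? d
  ... | yes Pd = ≤-trans (≤-reflexive (*-identityˡ (b ^ suc d))) (*-monoʳ-≤ b (heavy d Pd))
  ... | no _   = z≤n

  -- Each member j < d of P contributes a j * b^(d-1-j) ≥ b^(d-1) to the numeral.
  countBelow-≤-horner : ∀ b (a : ℕ → ℕ) → (∀ j → P j → b ^ j ≤ a j) →
                        ∀ d → countBelow P? d * b ^ d ≤ b * horner b a d
  countBelow-≤-horner b a heavy zero    = z≤n
  countBelow-≤-horner b a heavy (suc d) = begin
    (I + C) * (b * b ^ d)            ≡⟨ split I C b (b ^ d) ⟩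
    I * b ^ suc d + b * (C * b ^ d)  ≤⟨ +-mono-≤ (indicator-weight b a heavy d)
                                                 (*-monoʳ-≤ b (countBelow-≤-horner b a heavy d)) ⟩
    b * a d + b * (b * horner b a d) ≡⟨ merge b (a d) (horner b a d) ⟩
    b * horner b a (suc d)           ∎
    where
    open ≤-Reasoning
    I C : ℕ
    I = indicator (P? d)
    C = countBelow P? d
    split : ∀ i c b q → (i + c) * (b * q) ≡ i * (b * q) + b * (c * q)
    split = solve-∀
    merge : ∀ b x h → b * x + b * (b * h) ≡ b * (b * h + x)
    merge = solve-∀

  countBelow-bounded⇒¬¬eventually-∁ : ∀ M → (∀ d → countBelow P? d ≤ M) → ¬ ¬ Eventually (∁ P)
  countBelow-bounded⇒¬¬eventually-∁ M bounded never = unbounded (suc M) λ (d , M<count) →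
    <-irrefl refl (≤-trans M<count (bounded d))
    where
    unbounded : ∀ r → ¬ ¬ (∃[ d ] r ≤ countBelow P? d)
    unbounded zero    reached = reached (0 , z≤n)
    unbounded (suc r) reached = unbounded r λ (d , r≤count) → never (d , λ n d≤n Pn →
      reached (suc n , ≤-trans (s≤s (≤-trans r≤count (countBelow-mono (≤⇒≤′ d≤n))))
                               (≤-reflexive (sym (countBelow-suc Pn)))))

Prefixes-++⁻ : ∀ {k} (Π : Pred (Word k) 0ℓ) (w v : Word k) → Prefixes Π (w ++ v) → Prefixes Π w
Prefixes-++⁻ Π w v (π , π∈Π , s , wvs≡π) = π , π∈Π , v ++ s , trans (sym (++-assoc w v s)) wvs≡π

module Extensions {k} (Π : Pred (Word k) 0ℓ) (Π? : Decidable Π) where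

  extensions : Word k → ℕ → ℕ
  extensions w zero    = indicator (Π? w)
  extensions w (suc j) = ∑[ c < k ] extensions (w ++ [ c ]) j

  sum-indicator-words : ∀ w j → sum (map (λ u → indicator (Π? (w ++ u))) (words k j)) ≡ extensions w j
  sum-indicator-words w zero    = trans (+-identityʳ _) (cong (indicator ∘ Π?) (++-identityʳ w))
  sum-indicator-words w (suc j) = begin
    sum (map (weight w) (concatMap prepend (allFin k)))
      ≡⟨ sum-map-concatMap-tabulate (weight w) prepend id ⟩
    ∑[ c < k ] sum (map (weight w) (prepend c))
      ≡⟨ sum-cong-≗ (λ c → cong sum (reassociate c)) ⟩
    ∑[ c < k ] sum (map (weight (w ++ [ c ])) (words k j))
      ≡⟨ sum-cong-≗ (λ c → sum-indicator-words (w ++ [ c ]) j) ⟩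
    ∑[ c < k ] extensions (w ++ [ c ]) j ∎
    where
    open ≡-Reasoning
    weight : Word k → Word k → ℕ
    weight v u = indicator (Π? (v ++ u))
    prepend : Fin k → List (Word k)
    prepend c = map (c ∷_) (words k j)
    reassociate : ∀ c → map (weight w) (prepend c) ≡ map (weight (w ++ [ c ])) (words k j)
    reassociate c = trans (sym (map-∘ (words k j)))
                          (map-cong (λ u → cong (indicator ∘ Π?) (sym (++-assoc w [ c ] u))) (words k j))

  count≡extensions : ∀ n → count Π Π? n ≡ extensions [] n
  count≡extensions n = trans (length-filter≡sum-indicator Π? (words k n)) (sum-indicator-words [] n)

  extensions-dead : ∀ w → ¬ Prefixes Π w → ∀ j → extensions w j ≡ 0
  extensions-dead w w∉Γ zero with Π? w
  ... | yes w∈Π = contradiction (w , w∈Π , [] , ++-identityʳ w) w∉Γ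
  ... | no _    = refl
  extensions-dead w w∉Γ (suc j) = trans
    (sum-cong-≗ (λ c → extensions-dead (w ++ [ c ]) (w∉Γ ∘ Prefixes-++⁻ Π w [ c ]) j))
    (sum-replicate-zero k)

  module Kraft (escape : ∀ π → Π π → ∃[ c ] ¬ Prefixes Π (π ++ [ c ])) where

    -- A member w of Π contributes k^d, paid for by the child w c that has no extensions at all.
    kraft-step : ∀ w {d} (t : Fin k → ℕ) → (∀ c → t c ≤ k ^ d) →
                 (∀ c → ¬ Prefixes Π (w ++ [ c ]) → t c ≡ 0) →
                 indicator (Π? w) * k ^ d + ∑[ c < k ] t c ≤ k ^ suc d
    kraft-step w {d} t t≤ dead with Π? w
    ... | no _   = ∑-≤ t t≤
    ... | yes w∈Π with escape w w∈Π
    ...   | c , wc∉Γ = ≤-trans (≤-reflexive (cong (_+ ∑[ c < k ] t c) (*-identityˡ (k ^ d))))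
                               (∑-≤-vanishing t c t≤ (dead c wc∉Γ))

    extensions-kraft : ∀ d w → horner k (extensions w) d ≤ k ^ d
    extensions-kraft zero    w = z≤n
    extensions-kraft (suc d) w = begin
      horner k (extensions w) (suc d)
        ≡⟨ horner-shift k (extensions w) d ⟩
      indicator (Π? w) * k ^ d + horner k (λ j → ∑[ c < k ] extensions (w ++ [ c ]) j) d
        ≡⟨ cong (indicator (Π? w) * k ^ d +_) (horner-∑ k (λ c → extensions (w ++ [ c ])) d) ⟩
      indicator (Π? w) * k ^ d + ∑[ c < k ] horner k (extensions (w ++ [ c ])) d
        ≤⟨ kraft-step w {d} (λ c → horner k (extensions (w ++ [ c ])) d)
                            (λ c → extensions-kraft d (w ++ [ c ]))
                            (λ c wc∉Γ → horner-zeros k (extensions-dead (w ++ [ c ]) wc∉Γ) d) ⟩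
      k ^ suc d ∎
      where open ≤-Reasoning

    count-kraft : ∀ d → horner k (count Π Π?) d ≤ k ^ d
    count-kraft d = ≤-trans (≤-reflexive (horner-cong k count≡extensions d)) (extensions-kraft d [])

proposition4 : ExcludedMiddle 0ℓ →
    (k : ℕ) → 2 ≤ k →
    (Π : Pred (Word k) 0ℓ) (Π? : Decidable Π) →
    (∀ π → Π π → ∃[ c ] ¬ Prefixes Π (π ++ [ c ])) →
    ∀ m → ∃[ N ] (∀ n → N ≤ n → suc m * count Π Π? n < k ^ n)
proposition4 em zero      ()
proposition4 em k@(suc _) _ Π Π? escape m =
  em⇒dne em (¬¬-map (map₂ (λ rare n N≤n → ≰⇒> (rare n N≤n)))
                    (countBelow-bounded⇒¬¬eventually-∁ large? (k * suc m) large-rare))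
  where
  open Extensions Π Π?
  open Kraft escape

  large? : Decidable (λ n → k ^ n ≤ suc m * count Π Π? n)
  large? n = k ^ n ≤? suc m * count Π Π? n

  large-rare : ∀ d → countBelow large? d ≤ k * suc m
  large-rare d = *-cancelʳ-≤ _ _ (k ^ d) {{m^n≢0 k d}} (begin
    countBelow large? d * k ^ d                   ≤⟨ countBelow-≤-horner large? k _ (λ _ large → large) d ⟩
    k * horner k (λ j → suc m * count Π Π? j) d   ≡⟨ cong (k *_) (horner-*ˡ k (suc m) (count Π Π?) d) ⟩
    k * (suc m * horner k (count Π Π?) d)         ≤⟨ *-monoʳ-≤ k (*-monoʳ-≤ (suc m) (count-kraft d)) ⟩
    k * (suc m * k ^ d)                           ≡⟨ sym (*-assoc k (suc m) (k ^ d)) ⟩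
    k * suc m * k ^ d                             ∎)
    where open ≤-Reasoning
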